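{- Let $n,k,\lambda,\mu$ be nonnegative integers such that $0<k<n-1$, such that $(n-1-k)\mu = k(k-1-\lambda)$, and such that both numbers \[ \frac{1}{2}\left(n-1 \pm \frac{(n-1)(\lambda-\mu)+2k}{\sqrt{(\lambda-\mu)^2+4(k-\mu)}}\right) \] are nonnegative integers. Define $c_0,c_1,c_2,\ldots$ by $c_0=n$, $c_1=0$, and for $\ell\ge 2$, \[ c_{\ell} \,=\, \mu n k^{\ell-2} + (\lambda-\mu)\, c_{\ell-1} + (k-\mu)\, c_{\ell-2}. \] Then every prime $p$ divides the integer $c_p$. -}

module Defs where

open import Data.Nat as ℕ using (ℕ; zero; suc)
open import Data.Integer using (ℤ; +_; _+_; _-_; _*_; _^_; _≤_; _>_)
open import Data.Product using (Σ; _×_)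
open import Relation.Binary.PropositionalEquality using (_≡_)

-- The sequence c_ℓ of the paper, for parameters n k l μ (all in ℤ since
-- λ - μ and k - μ may be negative):
--   c₀ = n, c₁ = 0, c_ℓ = μ n k^(ℓ-2) + (λ-μ) c_{ℓ-1} + (k-μ) c_{ℓ-2}  (ℓ ≥ 2)
c : (n k l μ : ℕ) → ℕ → ℤ
c n k l μ zero = + n
c n k l μ (suc zero) = + 0
c n k l μ (suc (suc ℓ)) =
  (+ μ) * (+ n) * ((+ k) ^ ℓ)
  + ((+ l) - (+ μ)) * c n k l μ (suc ℓ)
  + ((+ k) - (+ μ)) * c n k l μ ℓ

disc : (k l μ : ℕ) → ℤ
disc k l μ = ((+ l) - (+ μ)) * ((+ l) - (+ μ)) + (+ 4) * ((+ k) - (+ μ))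

numer : (n k l μ : ℕ) → ℤ
numer n k l μ = ((+ n) - (+ 1)) * ((+ l) - (+ μ)) + (+ 2) * (+ k)

-- "Both numbers (1/2)(n-1 ± N/√D) are nonnegative integers."
-- Real-free encoding: D > 0 (so √D is a positive real) and there are
-- f g : ℕ with f = (n-1 + N/√D)/2, g = (n-1 - N/√D)/2, i.e.
-- f + g = n - 1 and f - g = N/√D.  Since √D > 0, the real equation
-- N = (f-g)·√D is equivalent to  N² = (f-g)²·D  together with N and f-g
-- having the same sign, i.e.  0 ≤ (f-g)·N.
MultiplicitiesIntegral : (n k l μ : ℕ) → Set
MultiplicitiesIntegral n k l μ =
  disc k l μ > + 0 ×
  Σ ℕ λ f → Σ ℕ λ g →
    ((+ f) + (+ g) ≡ (+ n) - (+ 1)) ×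
    (numer n k l μ * numer n k l μ ≡ ((+ f) - (+ g)) * ((+ f) - (+ g)) * disc k l μ) ×
    (+ 0 ≤ ((+ f) - (+ g)) * numer n k l μ)

module Submission where

-- Write a = λ - μ, b = k - μ, m = n - 1, N = m·a + 2k, D = a² + 4b, and let U
-- be the Lucas sequence U₀ = 0, U₁ = 1, U_{ℓ+2} = a·U_{ℓ+1} + b·U_ℓ.  The
-- feasibility condition makes k a root of x² = μn + a·x + b, which gives the
-- closed form  c_ℓ = k^ℓ + m·U_{ℓ+1} - (m·a + k)·U_ℓ.
--
-- Odd p = 2h + 1.  The freshman's dream (x + y)^p ≡ x^p + y^p (mod p), proved
-- in any commutative semiring from p ∣ C(p,j), is applied in ℤ[ω] with
-- ω² = aω + b.  It yields Fermat's little theorem, the trace congruence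
-- a^p ≡ b·U_{p-1} + U_{p+1} and the discriminant congruence U_p ≡ D^h; the
-- integrality N² = (f - g)²·D gives N·D^h ≡ N.  Together 2c_p ≡ N - N = 0.
--
-- p = 2.  Here c₂ = kn, and k, n both odd would make N² = (f - g)²·D fail
-- modulo 16.

open import Data.Nat as ℕ using (ℕ; zero; suc; z≤n; s≤s; _<_; _∸_)
import Data.Nat.Properties as ℕ
open import Data.Nat.Divisibility as ℕ using (divides)
open import Data.Nat.Combinatorics using (_C_; nC1≡n; nCn≡1; k>n⇒nCk≡0; nCk+nC[k+1]≡[n+1]C[k+1])
open import Data.Nat.Primality using (Prime; euclidsLemma; prime⇒irreducible)
open import Data.Fin as Fin using (Fin; zero; suc; toℕ; fromℕ; inject₁)
import Data.Fin.Properties as Fin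
open import Data.Product using (_×_; _,_; proj₁; proj₂; ∃-syntax)
open import Data.Sum using (_⊎_; inj₁; inj₂; [_,_]′)
open import Data.Empty using (⊥-elim)
open import Function using (id; _∘_)
open import Relation.Nullary using (contradiction)
open import Relation.Binary.PropositionalEquality as ≡ using (_≡_; _≢_; refl; cong; cong₂)
open import Relation.Binary.Bundles using (Setoid)
open import Algebra.Bundles using (CommutativeSemiring)
open import Algebra.Structures.Biased using (isCommutativeSemiringˡ; isCommutativeMonoidˡ)
open import Level using (0ℓ)
open import Defs

absorption : ∀ n k → suc k ℕ.* (suc n C suc k) ≡ suc n ℕ.* (n C k)
absorption zero    zero    = refl
absorption zero    (suc k) = begin
  suc (suc k) ℕ.* (1 C suc (suc k)) ≡⟨ cong (suc (suc k) ℕ.*_) (k>n⇒nCk≡0 {1} {suc (suc k)} (s≤s (s≤s z≤n))) ⟩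
  suc (suc k) ℕ.* 0                 ≡⟨ ℕ.*-zeroʳ (suc (suc k)) ⟩
  0                                 ≡⟨ cong (1 ℕ.*_) (k>n⇒nCk≡0 {0} {suc k} (s≤s z≤n)) ⟨
  1 ℕ.* (0 C suc k)                 ∎
  where open ≡.≡-Reasoning
absorption (suc n) zero    = begin
  1 ℕ.* (suc (suc n) C 1) ≡⟨ ℕ.*-identityˡ (suc (suc n) C 1) ⟩
  suc (suc n) C 1         ≡⟨ nC1≡n (suc (suc n)) ⟩
  suc (suc n)             ≡⟨ ℕ.*-identityʳ (suc (suc n)) ⟨
  suc (suc n) ℕ.* 1       ∎
  where open ≡.≡-Reasoning
absorption (suc n) (suc k) = begin
  suc (suc k) ℕ.* A                                   ≡⟨ cong (suc (suc k) ℕ.*_) pascal ⟨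
  suc (suc k) ℕ.* (X ℕ.+ Y)                           ≡⟨ ℕ.*-distribˡ-+ (suc (suc k)) X Y ⟩
  (X ℕ.+ suc k ℕ.* X) ℕ.+ suc (suc k) ℕ.* Y           ≡⟨ ℕ.+-assoc X _ _ ⟩
  X ℕ.+ (suc k ℕ.* X ℕ.+ suc (suc k) ℕ.* Y)           ≡⟨ cong (X ℕ.+_) (cong₂ ℕ._+_ (absorption n k) (absorption n (suc k))) ⟩
  X ℕ.+ (suc n ℕ.* (n C k) ℕ.+ suc n ℕ.* (n C suc k)) ≡⟨ cong (X ℕ.+_) (ℕ.*-distribˡ-+ (suc n) (n C k) (n C suc k)) ⟨
  X ℕ.+ suc n ℕ.* (n C k ℕ.+ n C suc k)               ≡⟨ cong (λ t → X ℕ.+ suc n ℕ.* t) (nCk+nC[k+1]≡[n+1]C[k+1] n k) ⟩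
  X ℕ.+ suc n ℕ.* X                                   ∎
  where
  open ≡.≡-Reasoning
  A : ℕ
  A = suc (suc n) C suc (suc k)
  X : ℕ
  X = suc n C suc k
  Y : ℕ
  Y = suc n C suc (suc k)
  pascal : X ℕ.+ Y ≡ A
  pascal = nCk+nC[k+1]≡[n+1]C[k+1] (suc n) (suc k)

-- A prime p divides every inner binomial coefficient C(p,j), 0 < j < p:
-- by absorption p divides j·C(p,j), and p cannot divide j.
prime∣binomial : ∀ {p j} → Prime p → 0 < j → j < p → p ℕ.∣ p C j
prime∣binomial {suc q} {suc i} pr _ j<p
  with euclidsLemma (suc i) (suc q C suc i) pr
         (divides (q C i) (≡.trans (absorption q i) (ℕ.*-comm (suc q) (q C i))))
... | inj₁ p∣j   = contradiction (ℕ.∣⇒≤ p∣j) (ℕ.<⇒≱ j<p)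
... | inj₂ p∣pCj = p∣pCj

-- The freshman's dream: in any commutative semiring, (x + y)^p and
-- x^p + y^p differ by a p-fold multiple, since every inner term of the
-- binomial expansion carries a coefficient C(p,j) divisible by p.
module FreshmanDream {c ℓ} (S : CommutativeSemiring c ℓ) where

  open CommutativeSemiring S hiding (zero)
  open import Algebra.Properties.CommutativeSemiring.Binomial S using (theorem; binomialTerm)
  open import Algebra.Properties.Semiring.Exp semiring using (_^_)
  open import Algebra.Properties.Semiring.Sum semiring using (sum; sum-init-last; sum-replicate; sum-replicate-zero)
  open import Algebra.Properties.CommutativeMonoid.Mult +-commutativeMonoid
    using (×-assocˡ; ×-distrib-+; ×-congˡ) renaming (_×_ to _·_)
  open import Algebra.Properties.CommutativeSemigroup +-commutativeSemigroup using (x∙yz≈zx∙y)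
  open import Relation.Binary.Reasoning.Setoid setoid

  Multiple : ℕ → Carrier → Set _
  Multiple n w = ∃[ z ] w ≈ n · z

  multiple-+ : ∀ {n v w} → Multiple n v → Multiple n w → Multiple n (v + w)
  multiple-+ {n} (y , v≈ny) (z , w≈nz) = y + z , trans (+-cong v≈ny w≈nz) (sym (×-distrib-+ y z n))

  multiple-· : ∀ {m n} → n ℕ.∣ m → ∀ t → Multiple n (m · t)
  multiple-· {n = n} (divides d refl) t = d · t , trans (×-congˡ (ℕ.*-comm d n)) (sym (×-assocˡ t n d))

  sum-multiple : ∀ n {m} (t : Fin m → Carrier) → (∀ i → Multiple n (t i)) → Multiple n (sum t)
  sum-multiple n {zero}  t _    = 0# , trans (sym (sum-replicate-zero n)) (sum-replicate n)
  sum-multiple n {suc m} t mult = multiple-+ {n} (mult zero) (sum-multiple n (t ∘ suc) (mult ∘ suc))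

  freshman : ∀ {p} → Prime p → ∀ x y → ∃[ z ] (x + y) ^ p ≈ (x ^ p + y ^ p) + p · z
  freshman {p@(suc q)} pr x y = z , (begin
    (x + y) ^ p                                 ≈⟨ theorem p x y ⟩
    term zero + sum inner                       ≈⟨ +-congˡ (sum-init-last inner) ⟩
    term zero + (sum middle + term (fromℕ p))   ≈⟨ +-cong bottom-term (+-cong middle≈pz top-term) ⟩
    y ^ p + (p · z + x ^ p)                     ≈⟨ x∙yz≈zx∙y (y ^ p) (p · z) (x ^ p) ⟩
    (x ^ p + y ^ p) + p · z                     ∎)
    where
    term : Fin (suc p) → Carrier
    term = binomialTerm x y p
    inner : Fin p → Carrier
    inner i = term (suc i)
    middle : Fin q → Carrier
    middle i = term (suc (inject₁ i))

    bottom-term : term zero ≈ y ^ p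
    bottom-term = trans (+-identityʳ _) (*-identityˡ _)

    top-term : term (fromℕ p) ≈ x ^ p
    top-term = top (toℕ (fromℕ p)) (Fin.toℕ-fromℕ p)
      where
      top : ∀ j → j ≡ p → (p C j) · (x ^ j * y ^ (p ℕ.∸ j)) ≈ x ^ p
      top j refl rewrite nCn≡1 p | ℕ.n∸n≡0 p = trans (+-identityʳ _) (*-identityʳ _)

    middle-multiple : ∀ i → Multiple p (middle i)
    middle-multiple i = multiple-· (prime∣binomial pr (s≤s z≤n) (s≤s j<q)) _
      where
      j<q : toℕ (inject₁ i) < q
      j<q = ≡.subst (_< q) (≡.sym (Fin.toℕ-inject₁ i)) (Fin.toℕ<n i)

    z : Carrier
    z = proj₁ (sum-multiple p middle middle-multiple)
    middle≈pz : sum middle ≈ p · z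
    middle≈pz = proj₂ (sum-multiple p middle middle-multiple)

open import Data.Integer as ℤ using (ℤ; +_; -[1+_]; _+_; _-_; _*_; -_; _^_)
import Data.Integer.Properties as ℤ
open import Data.Integer.Divisibility using (_∣_)
import Data.Integer.Divisibility.Signed as Signed
open Signed using (divides; ∣m∣n⇒∣m+n; ∣m∣n⇒∣m-n; ∣m⇒∣-m; ∣m⇒∣m*n; ∣n⇒∣m*n; ∣-refl; ∣⇒∣ᵤ; ∣ᵤ⇒∣)
open import Data.Integer.Tactic.RingSolver using (solve-∀)

-- Congruence of integers modulo P: P divides the difference.  (A record,
-- so that x and y can be inferred from a proof.)
infix 4 _≡_mod_
record _≡_mod_ (x y P : ℤ) : Set where
  constructor by-divisibility
  field ∣-difference : P Signed.∣ x - y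
open _≡_mod_ public

module Modular (P : ℤ) where

  private
    diff-refl : ∀ x → x - x ≡ + 0
    diff-refl = solve-∀
    diff-sym : ∀ x y → y - x ≡ - (x - y)
    diff-sym = solve-∀
    diff-trans : ∀ x y z → x - z ≡ (x - y) + (y - z)
    diff-trans = solve-∀
    diff-+ : ∀ x x′ y y′ → (x + y) - (x′ + y′) ≡ (x - x′) + (y - y′)
    diff-+ = solve-∀
    diff-sub : ∀ x x′ y y′ → (x - y) - (x′ - y′) ≡ (x - x′) - (y - y′)
    diff-sub = solve-∀
    diff-* : ∀ x x′ y y′ → x * y - x′ * y′ ≡ (x - x′) * y + x′ * (y - y′)
    diff-* = solve-∀
    diff-0 : ∀ x → x - + 0 ≡ x
    diff-0 = solve-∀
    diff-multiple : ∀ P y z → y + P * z - y ≡ z * P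
    diff-multiple = solve-∀
    diff-halve : ∀ H x y → x - y ≡ (x - y) * (+ 1 + + 2 * H) - H * (+ 2 * x - + 2 * y)
    diff-halve = solve-∀

  infix 4 _≈_
  _≈_ : ℤ → ℤ → Set
  x ≈ y = x ≡ y mod P

  ≈-reflexive : ∀ {x y} → x ≡ y → x ≈ y
  ≈-reflexive {x} refl = by-divisibility (≡.subst (P Signed.∣_) (≡.sym (diff-refl x)) (divides (+ 0) refl))

  ≈-sym : ∀ {x y} → x ≈ y → y ≈ x
  ≈-sym {x} {y} (by-divisibility d) = by-divisibility (≡.subst (P Signed.∣_) (≡.sym (diff-sym x y)) (∣m⇒∣-m d))

  ≈-trans : ∀ {x y z} → x ≈ y → y ≈ z → x ≈ z
  ≈-trans {x} {y} {z} (by-divisibility d) (by-divisibility e) =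
    by-divisibility (≡.subst (P Signed.∣_) (≡.sym (diff-trans x y z)) (∣m∣n⇒∣m+n d e))

  +-cong : ∀ {x x′ y y′} → x ≈ x′ → y ≈ y′ → x + y ≈ x′ + y′
  +-cong {x} {x′} {y} {y′} (by-divisibility d) (by-divisibility e) =
    by-divisibility (≡.subst (P Signed.∣_) (≡.sym (diff-+ x x′ y y′)) (∣m∣n⇒∣m+n d e))

  sub-cong : ∀ {x x′ y y′} → x ≈ x′ → y ≈ y′ → x - y ≈ x′ - y′
  sub-cong {x} {x′} {y} {y′} (by-divisibility d) (by-divisibility e) =
    by-divisibility (≡.subst (P Signed.∣_) (≡.sym (diff-sub x x′ y y′)) (∣m∣n⇒∣m-n d e))

  *-cong : ∀ {x x′ y y′} → x ≈ x′ → y ≈ y′ → x * y ≈ x′ * y′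
  *-cong {x} {x′} {y} {y′} (by-divisibility d) (by-divisibility e) =
    by-divisibility (≡.subst (P Signed.∣_) (≡.sym (diff-* x x′ y y′))
                             (∣m∣n⇒∣m+n (∣m⇒∣m*n y d) (∣n⇒∣m*n x′ e)))

  *-congˡ : ∀ x {y y′} → y ≈ y′ → x * y ≈ x * y′
  *-congˡ x = *-cong (≈-reflexive {x} refl)

  *-congʳ : ∀ y {x x′} → x ≈ x′ → x * y ≈ x′ * y
  *-congʳ y x≈x′ = *-cong x≈x′ (≈-reflexive {y} refl)

  ∣⇒≈0 : ∀ {x} → P Signed.∣ x → x ≈ + 0
  ∣⇒≈0 {x} d = by-divisibility (≡.subst (P Signed.∣_) (≡.sym (diff-0 x)) d)

  ≈-by-multiple : ∀ {x y} z → x ≡ y + P * z → x ≈ y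
  ≈-by-multiple {x} {y} z refl = by-divisibility (divides z (diff-multiple P y z))

  halve : ∀ H {x y} → P ≡ + 1 + + 2 * H → + 2 * x ≈ + 2 * y → x ≈ y
  halve H {x} {y} refl (by-divisibility d) =
    by-divisibility (≡.subst (P Signed.∣_) (≡.sym (diff-halve H x y))
                             (∣m∣n⇒∣m-n (∣n⇒∣m*n (x - y) ∣-refl) (∣n⇒∣m*n H d)))

  ≈0⇒∣ : ∀ {x} → x ≈ + 0 → P Signed.∣ x
  ≈0⇒∣ {x} (by-divisibility d) = ≡.subst (P Signed.∣_) (diff-0 x) d

  setoid : Setoid 0ℓ 0ℓ
  setoid = record
    { Carrier = ℤ ; _≈_ = _≈_
    ; isEquivalence = record { refl = ≈-reflexive refl ; sym = ≈-sym ; trans = ≈-trans } }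

  open import Relation.Binary.Reasoning.Setoid setoid public

odd-modulus : ∀ h → + suc (2 ℕ.* h) ≡ + 1 + + 2 * + h
odd-modulus h = cong (_+_ (+ 1)) (ℤ.pos-* 2 h)

-- The ring ℤ[ω] with ω² = aω + b: the pair (x , y) stands for x + yω.
-- It is a commutative semiring with propositional equality, so the
-- freshman's dream applies to it.
module QuadraticRing (a b : ℤ) where

  Q : Set
  Q = ℤ × ℤ

  infixl 6 _⊕_
  infixl 7 _⊗_

  _⊕_ : Q → Q → Q
  (x₁ , y₁) ⊕ (x₂ , y₂) = (x₁ + x₂ , y₁ + y₂)

  _⊗_ : Q → Q → Q
  (x₁ , y₁) ⊗ (x₂ , y₂) = (x₁ * x₂ + b * (y₁ * y₂) , x₁ * y₂ + x₂ * y₁ + a * (y₁ * y₂))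

  0Q 1Q : Q
  0Q = (+ 0 , + 0)
  1Q = (+ 1 , + 0)

  private
    ⊗-assoc₁ : ∀ a b x₁ y₁ x₂ y₂ x₃ y₃ →
      (x₁ * x₂ + b * (y₁ * y₂)) * x₃ + b * ((x₁ * y₂ + x₂ * y₁ + a * (y₁ * y₂)) * y₃)
        ≡ x₁ * (x₂ * x₃ + b * (y₂ * y₃)) + b * (y₁ * (x₂ * y₃ + x₃ * y₂ + a * (y₂ * y₃)))
    ⊗-assoc₁ = solve-∀
    ⊗-assoc₂ : ∀ a b x₁ y₁ x₂ y₂ x₃ y₃ →
      (x₁ * x₂ + b * (y₁ * y₂)) * y₃ + x₃ * (x₁ * y₂ + x₂ * y₁ + a * (y₁ * y₂))
        + a * ((x₁ * y₂ + x₂ * y₁ + a * (y₁ * y₂)) * y₃)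
        ≡ x₁ * (x₂ * y₃ + x₃ * y₂ + a * (y₂ * y₃)) + (x₂ * x₃ + b * (y₂ * y₃)) * y₁
          + a * (y₁ * (x₂ * y₃ + x₃ * y₂ + a * (y₂ * y₃)))
    ⊗-assoc₂ = solve-∀
    ⊗-identityˡ₁ : ∀ b x y → + 1 * x + b * (+ 0 * y) ≡ x
    ⊗-identityˡ₁ = solve-∀
    ⊗-identityˡ₂ : ∀ a x y → + 1 * y + x * + 0 + a * (+ 0 * y) ≡ y
    ⊗-identityˡ₂ = solve-∀
    ⊗-comm₁ : ∀ b x₁ y₁ x₂ y₂ → x₁ * x₂ + b * (y₁ * y₂) ≡ x₂ * x₁ + b * (y₂ * y₁)
    ⊗-comm₁ = solve-∀
    ⊗-comm₂ : ∀ a x₁ y₁ x₂ y₂ → x₁ * y₂ + x₂ * y₁ + a * (y₁ * y₂) ≡ x₂ * y₁ + x₁ * y₂ + a * (y₂ * y₁)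
    ⊗-comm₂ = solve-∀
    distribʳ₁ : ∀ b x₁ y₁ x₂ y₂ x₃ y₃ →
      (x₂ + x₃) * x₁ + b * ((y₂ + y₃) * y₁) ≡ (x₂ * x₁ + b * (y₂ * y₁)) + (x₃ * x₁ + b * (y₃ * y₁))
    distribʳ₁ = solve-∀
    distribʳ₂ : ∀ a x₁ y₁ x₂ y₂ x₃ y₃ →
      (x₂ + x₃) * y₁ + x₁ * (y₂ + y₃) + a * ((y₂ + y₃) * y₁)
        ≡ (x₂ * y₁ + x₁ * y₂ + a * (y₂ * y₁)) + (x₃ * y₁ + x₁ * y₃ + a * (y₃ * y₁))
    distribʳ₂ = solve-∀
    zeroˡ₁ : ∀ b x y → + 0 * x + b * (+ 0 * y) ≡ + 0
    zeroˡ₁ = solve-∀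
    zeroˡ₂ : ∀ a x y → + 0 * y + x * + 0 + a * (+ 0 * y) ≡ + 0
    zeroˡ₂ = solve-∀

  ℤ[ω] : CommutativeSemiring 0ℓ 0ℓ
  ℤ[ω] = record
    { Carrier = Q ; _≈_ = _≡_ ; _+_ = _⊕_ ; _*_ = _⊗_ ; 0# = 0Q ; 1# = 1Q
    ; isCommutativeSemiring = isCommutativeSemiringˡ record
      { +-isCommutativeMonoid = isCommutativeMonoidˡ record
        { isSemigroup = record
          { isMagma = record { isEquivalence = ≡.isEquivalence ; ∙-cong = cong₂ _⊕_ }
          ; assoc = λ { (x₁ , y₁) (x₂ , y₂) (x₃ , y₃) → cong₂ _,_ (ℤ.+-assoc x₁ x₂ x₃) (ℤ.+-assoc y₁ y₂ y₃) } }
        ; identityˡ = λ { (x , y) → cong₂ _,_ (ℤ.+-identityˡ x) (ℤ.+-identityˡ y) }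
        ; comm = λ { (x₁ , y₁) (x₂ , y₂) → cong₂ _,_ (ℤ.+-comm x₁ x₂) (ℤ.+-comm y₁ y₂) } }
      ; *-isCommutativeMonoid = isCommutativeMonoidˡ record
        { isSemigroup = record
          { isMagma = record { isEquivalence = ≡.isEquivalence ; ∙-cong = cong₂ _⊗_ }
          ; assoc = λ { (x₁ , y₁) (x₂ , y₂) (x₃ , y₃) →
              cong₂ _,_ (⊗-assoc₁ a b x₁ y₁ x₂ y₂ x₃ y₃) (⊗-assoc₂ a b x₁ y₁ x₂ y₂ x₃ y₃) } }
        ; identityˡ = λ { (x , y) → cong₂ _,_ (⊗-identityˡ₁ b x y) (⊗-identityˡ₂ a x y) }
        ; comm = λ { (x₁ , y₁) (x₂ , y₂) → cong₂ _,_ (⊗-comm₁ b x₁ y₁ x₂ y₂) (⊗-comm₂ a x₁ y₁ x₂ y₂) } }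
      ; distribʳ = λ { (x₁ , y₁) (x₂ , y₂) (x₃ , y₃) →
          cong₂ _,_ (distribʳ₁ b x₁ y₁ x₂ y₂ x₃ y₃) (distribʳ₂ a x₁ y₁ x₂ y₂ x₃ y₃) }
      ; zeroˡ = λ { (x , y) → cong₂ _,_ (zeroˡ₁ b x y) (zeroˡ₂ a x y) }
      }
    }

  open import Algebra.Properties.Semiring.Exp (CommutativeSemiring.semiring ℤ[ω]) public
    using (^-assocʳ) renaming (_^_ to _^Q_)
  open import Algebra.Properties.CommutativeMonoid.Mult (CommutativeSemiring.+-commutativeMonoid ℤ[ω])
    using () renaming (_×_ to _·_)

  ·-components : ∀ n u → n · u ≡ (+ n * proj₁ u , + n * proj₂ u)
  ·-components zero    (x , y) = cong₂ _,_ (ℤ.*-zeroˡ x) (ℤ.*-zeroˡ y)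
  ·-components (suc n) (x , y) = ≡.trans (cong ((x , y) ⊕_) (·-components n (x , y)))
                                         (cong₂ _,_ (≡.sym (ℤ.suc-* (+ n) x)) (≡.sym (ℤ.suc-* (+ n) y)))

  scalar-^ : ∀ x n → (x , + 0) ^Q n ≡ (x ^ n , + 0)
  scalar-^ x zero    = refl
  scalar-^ x (suc n) = ≡.trans (cong ((x , + 0) ⊗_) (scalar-^ x n))
                               (cong₂ _,_ (scalar-product₁ b x (x ^ n)) (scalar-product₂ a x (x ^ n)))
    where
    scalar-product₁ : ∀ b x y → x * y + b * (+ 0 * + 0) ≡ x * y
    scalar-product₁ = solve-∀
    scalar-product₂ : ∀ a x y → x * + 0 + y * + 0 + a * (+ 0 * + 0) ≡ + 0
    scalar-product₂ = solve-∀

  frobenius : ∀ {p} → Prime p → ∀ u v →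
    proj₁ ((u ⊕ v) ^Q p) ≡ proj₁ (u ^Q p) + proj₁ (v ^Q p) mod + p ×
    proj₂ ((u ⊕ v) ^Q p) ≡ proj₂ (u ^Q p) + proj₂ (v ^Q p) mod + p
  frobenius {p} pr u v with FreshmanDream.freshman ℤ[ω] pr u v
  ... | (z₁ , z₂) , dream = ≈-by-multiple z₁ (cong proj₁ expanded) , ≈-by-multiple z₂ (cong proj₂ expanded)
    where
    open Modular (+ p)
    expanded : (u ⊕ v) ^Q p ≡ (u ^Q p ⊕ v ^Q p) ⊕ (+ p * z₁ , + p * z₂)
    expanded = ≡.trans dream (cong (u ^Q p ⊕ v ^Q p ⊕_) (·-components p (z₁ , z₂)))

euclid : ∀ {p} → Prime p → ∀ x y → + p Signed.∣ x * y → + p Signed.∣ x ⊎ + p Signed.∣ y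
euclid {p} pr x y p∣xy with euclidsLemma ℤ.∣ x ∣ ℤ.∣ y ∣ pr (≡.subst (p ℕ.∣_) (ℤ.abs-* x y) (∣⇒∣ᵤ p∣xy))
... | inj₁ p∣x = inj₁ (∣ᵤ⇒∣ p∣x)
... | inj₂ p∣y = inj₂ (∣ᵤ⇒∣ p∣y)

-- Fermat's little theorem for integers.  The additivity of x ↦ x^p is
-- the freshman's dream applied to the scalars of ℤ[ω] (for any a, b).
module Fermat {p} (pr : Prime p) where

  open Modular (+ p)
  open QuadraticRing (+ 0) (+ 0) using (frobenius; scalar-^; _⊕_; _^Q_)

  ^p-additive : ∀ x y → (x + y) ^ p ≈ x ^ p + y ^ p
  ^p-additive x y = begin
    (x + y) ^ p                                          ≡⟨ cong proj₁ (scalar-^ (x + y) p) ⟨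
    proj₁ (((x , + 0) ⊕ (y , + 0)) ^Q p)                 ≈⟨ proj₁ (frobenius pr (x , + 0) (y , + 0)) ⟩
    proj₁ ((x , + 0) ^Q p) + proj₁ ((y , + 0) ^Q p)      ≡⟨ cong₂ _+_ (cong proj₁ (scalar-^ x p)) (cong proj₁ (scalar-^ y p)) ⟩
    x ^ p + y ^ p                                        ∎

  -- Induction on m ≥ 0 via (m + 1)^p ≡ m^p + 1; negative x via x^p + (-x)^p ≡ 0^p.
  fermat-ℕ : ∀ m → (+ m) ^ p ≈ + m
  fermat-ℕ zero    = ≈-reflexive (zero^p p pr)
    where
    zero^p : ∀ p → Prime p → (+ 0) ^ p ≡ + 0
    zero^p (suc q) _ = refl
  fermat-ℕ (suc m) = begin
    (+ 1 + + m) ^ p       ≈⟨ ^p-additive (+ 1) (+ m) ⟩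
    (+ 1) ^ p + (+ m) ^ p ≈⟨ +-cong (≈-reflexive (ℤ.^-zeroˡ p)) (fermat-ℕ m) ⟩
    + 1 + + m             ∎

  fermat : ∀ x → x ^ p ≈ x
  fermat (+ m)    = fermat-ℕ m
  fermat -[1+ m ] = begin
    y ^ p                  ≡⟨ cancel (x ^ p) (y ^ p) ⟩
    (x ^ p + y ^ p) - x ^ p ≈⟨ sub-cong (≈-sym (^p-additive x y)) (fermat-ℕ (suc m)) ⟩
    (x + y) ^ p - x        ≡⟨ cong (λ t → t ^ p - x) (ℤ.+-inverseʳ x) ⟩
    (+ 0) ^ p - x          ≈⟨ sub-cong (fermat-ℕ 0) (≈-reflexive refl) ⟩
    + 0 - x                ≡⟨ ℤ.+-identityˡ y ⟩
    y                      ∎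
    where
    x : ℤ
    x = + suc m
    y : ℤ
    y = -[1+ m ]
    cancel : ∀ X Y → Y ≡ (X + Y) - X
    cancel = solve-∀

^-distrib-* : ∀ x y h → (x * y) ^ h ≡ x ^ h * y ^ h
^-distrib-* x y zero    = refl
^-distrib-* x y (suc h) = ≡.trans (cong (x * y *_) (^-distrib-* x y h)) (interchange x y (x ^ h) (y ^ h))
  where
  interchange : ∀ x y X Y → x * y * (X * Y) ≡ x * X * (y * Y)
  interchange = solve-∀

^-even : ∀ x h → x ^ (2 ℕ.* h) ≡ (x * x) ^ h
^-even x h = ≡.trans (≡.sym (ℤ.^-*-assoc x 2 h)) (cong (_^ h) (cong (x *_) (ℤ.*-identityʳ x)))

square-powers : ∀ N e D h → N * N ≡ e * e * D → N ^ (2 ℕ.* h) ≡ e ^ (2 ℕ.* h) * D ^ h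
square-powers N e D h N²≡e²D = begin
  N ^ (2 ℕ.* h)           ≡⟨ ^-even N h ⟩
  (N * N) ^ h             ≡⟨ cong (_^ h) N²≡e²D ⟩
  (e * e * D) ^ h         ≡⟨ ^-distrib-* (e * e) D h ⟩
  (e * e) ^ h * D ^ h     ≡⟨ cong (_* D ^ h) (^-even e h) ⟨
  e ^ (2 ℕ.* h) * D ^ h   ∎
  where open ≡.≡-Reasoning

-- Multiplied by e, the claim below follows from Fermat's little theorem:
-- e·(N·D^h) ≡ e^p·N·D^h = e·N·(e^2h·D^h) = e·N^p ≡ e·N.
euler-criterion-scaled : ∀ h → Prime (suc (2 ℕ.* h)) → ∀ N e D → N * N ≡ e * e * D →
                         e * (N * D ^ h) ≡ e * N mod + suc (2 ℕ.* h)
euler-criterion-scaled h pr N e D N²≡e²D = begin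
  e * (N * D ^ h)                    ≈⟨ *-congʳ (N * D ^ h) (≈-sym (fermat e)) ⟩
  e * e ^ (2 ℕ.* h) * (N * D ^ h)    ≡⟨ regroup₁ e (e ^ (2 ℕ.* h)) N (D ^ h) ⟩
  e * N * (e ^ (2 ℕ.* h) * D ^ h)    ≡⟨ cong (e * N *_) (square-powers N e D h N²≡e²D) ⟨
  e * N * N ^ (2 ℕ.* h)              ≡⟨ regroup₂ e N (N ^ (2 ℕ.* h)) ⟩
  e * N ^ suc (2 ℕ.* h)              ≈⟨ *-congˡ e (fermat N) ⟩
  e * N                              ∎
  where
  open Modular (+ suc (2 ℕ.* h))
  open Fermat pr
  regroup₁ : ∀ e E N Dh → e * E * (N * Dh) ≡ e * N * (E * Dh)
  regroup₁ = solve-∀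
  regroup₂ : ∀ e N M → e * N * M ≡ e * (N * M)
  regroup₂ = solve-∀

-- If N² = e²·D then N·D^h ≡ N modulo the prime p = 2h + 1.  When p ∤ e this
-- is Euler's criterion for the square D ≡ (N/e)²; when p ∣ e, p divides N²
-- and hence N, so both sides vanish.
euler-criterion : ∀ h → Prime (suc (2 ℕ.* h)) → ∀ N e D → N * N ≡ e * e * D →
                  N * D ^ h ≡ N mod + suc (2 ℕ.* h)
euler-criterion h pr N e D N²≡e²D = [ both-vanish , by-divisibility ]′ (euclid pr e (N * D ^ h - N) p∣e[ND^h-N])
  where
  p : ℕ
  p = suc (2 ℕ.* h)
  open Modular (+ p)
  factor : ∀ e X Y → e * X - e * Y ≡ e * (X - Y)
  factor = solve-∀
  p∣e[ND^h-N] : + p Signed.∣ e * (N * D ^ h - N)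
  p∣e[ND^h-N] = ≡.subst (+ p Signed.∣_) (factor e (N * D ^ h) N)
                        (∣-difference (euler-criterion-scaled h pr N e D N²≡e²D))
  both-vanish : + p Signed.∣ e → N * D ^ h ≈ N
  both-vanish p∣e = ≈-trans (∣⇒≈0 (∣m⇒∣m*n (D ^ h) p∣N)) (≈-sym (∣⇒≈0 p∣N))
    where
    p∣N² : + p Signed.∣ N * N
    p∣N² = ≡.subst (+ p Signed.∣_) (≡.sym N²≡e²D) (∣m⇒∣m*n D (∣m⇒∣m*n e p∣e))
    p∣N : + p Signed.∣ N
    p∣N = [ id , id ]′ (euclid pr N N p∣N²)

lucas : ℤ → ℤ → ℕ → ℤ
lucas a b zero          = + 0
lucas a b (suc zero)    = + 1
lucas a b (suc (suc ℓ)) = a * lucas a b (suc ℓ) + b * lucas a b ℓ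

-- Congruences for U_p modulo a prime p, obtained from the Frobenius map of
-- ℤ[ω], ω² = aω + b.  Its conjugate ω̄ = a - ω and the difference
-- δ = ω - ω̄ (with δ² = D = a² + 4b) have powers described by U.
module LucasCongruences (a b : ℤ) where

  open QuadraticRing a b

  U : ℕ → ℤ
  U = lucas a b

  D : ℤ
  D = a * a + + 4 * b

  ω ω̄ δ : Q
  ω = (+ 0 , + 1)
  ω̄ = (a , - + 1)
  δ = (- a , + 2)

  private
    ω-power₀₁ : ∀ b → + 0 * + 1 + b * (+ 1 * + 0) ≡ b * + 0
    ω-power₀₁ = solve-∀
    ω-power₀₂ : ∀ a → + 0 * + 0 + + 1 * + 1 + a * (+ 1 * + 0) ≡ + 1
    ω-power₀₂ = solve-∀
    ω-power₁ : ∀ b U₀ U₁ → + 0 * (b * U₀) + b * (+ 1 * U₁) ≡ b * U₁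
    ω-power₁ = solve-∀
    ω-power₂ : ∀ a b U₀ U₁ → + 0 * U₁ + b * U₀ * + 1 + a * (+ 1 * U₁) ≡ a * U₁ + b * U₀
    ω-power₂ = solve-∀
    ω̄-power₀₁ : ∀ a b → a * + 1 + b * (- + 1 * + 0) ≡ a * + 1 + b * + 0
    ω̄-power₀₁ = solve-∀
    ω̄-power₀₂ : ∀ a → a * + 0 + + 1 * - + 1 + a * (- + 1 * + 0) ≡ - + 1
    ω̄-power₀₂ = solve-∀
    ω̄-power₁ : ∀ a b U₁ U₂ → a * U₂ + b * (- + 1 * - U₁) ≡ a * U₂ + b * U₁
    ω̄-power₁ = solve-∀
    ω̄-power₂ : ∀ a U₁ U₂ → a * - U₁ + U₂ * - + 1 + a * (- + 1 * - U₁) ≡ - U₂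
    ω̄-power₂ = solve-∀
    δ²₁ : ∀ a b → - a * (- a * + 1 + b * (+ 2 * + 0)) + b * (+ 2 * (- a * + 0 + + 1 * + 2 + a * (+ 2 * + 0)))
                    ≡ a * a + + 4 * b
    δ²₁ = solve-∀
    δ²₂ : ∀ a b → - a * (- a * + 0 + + 1 * + 2 + a * (+ 2 * + 0)) + (- a * + 1 + b * (+ 2 * + 0)) * + 2
                    + a * (+ 2 * (- a * + 0 + + 1 * + 2 + a * (+ 2 * + 0))) ≡ + 0
    δ²₂ = solve-∀
    δ-scalar₁ : ∀ a b E → - a * E + b * (+ 2 * + 0) ≡ - a * E
    δ-scalar₁ = solve-∀
    δ-scalar₂ : ∀ a E → - a * + 0 + E * + 2 + a * (+ 2 * + 0) ≡ + 2 * E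
    δ-scalar₂ = solve-∀

  ω-power : ∀ ℓ → ω ^Q suc ℓ ≡ (b * U ℓ , U (suc ℓ))
  ω-power zero    = cong₂ _,_ (ω-power₀₁ b) (ω-power₀₂ a)
  ω-power (suc ℓ) = ≡.trans (cong (ω ⊗_) (ω-power ℓ))
                            (cong₂ _,_ (ω-power₁ b (U ℓ) (U (suc ℓ))) (ω-power₂ a b (U ℓ) (U (suc ℓ))))

  ω̄-power : ∀ ℓ → ω̄ ^Q suc ℓ ≡ (U (suc (suc ℓ)) , - U (suc ℓ))
  ω̄-power zero    = cong₂ _,_ (ω̄-power₀₁ a b) (ω̄-power₀₂ a)
  ω̄-power (suc ℓ) = ≡.trans (cong (ω̄ ⊗_) (ω̄-power ℓ))
                            (cong₂ _,_ (ω̄-power₁ a b (U (suc ℓ)) (U (suc (suc ℓ))))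
                                       (ω̄-power₂ a (U (suc ℓ)) (U (suc (suc ℓ)))))

  δ-power : ∀ h → δ ^Q suc (2 ℕ.* h) ≡ (- a * D ^ h , + 2 * D ^ h)
  δ-power h = begin
    δ ⊗ δ ^Q (2 ℕ.* h)           ≡⟨ cong (δ ⊗_) (^-assocʳ δ 2 h) ⟨
    δ ⊗ (δ ^Q 2) ^Q h            ≡⟨ cong (λ u → δ ⊗ u ^Q h) (cong₂ _,_ (δ²₁ a b) (δ²₂ a b)) ⟩
    δ ⊗ (D , + 0) ^Q h           ≡⟨ cong (δ ⊗_) (scalar-^ D h) ⟩
    δ ⊗ (D ^ h , + 0)            ≡⟨ cong₂ _,_ (δ-scalar₁ a b (D ^ h)) (δ-scalar₂ a (D ^ h)) ⟩
    (- a * D ^ h , + 2 * D ^ h)  ∎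
    where open ≡.≡-Reasoning

  -- Trace: ω + ω̄ = a, so a^p ≡ ω^p + ω̄^p has first component b·U_{p-1} + U_{p+1}.
  trace-congruence : ∀ {q} → Prime (suc q) → a ^ suc q ≡ b * U q + U (suc (suc q)) mod + suc q
  trace-congruence {q} pr = begin
    a ^ p                            ≡⟨ cong proj₁ (scalar-^ a p) ⟨
    proj₁ ((a , + 0) ^Q p)           ≡⟨ cong (λ u → proj₁ (u ^Q p)) ω+ω̄≡a ⟨
    proj₁ ((ω ⊕ ω̄) ^Q p)             ≈⟨ proj₁ (frobenius pr ω ω̄) ⟩
    proj₁ (ω ^Q p) + proj₁ (ω̄ ^Q p)  ≡⟨ cong₂ _+_ (cong proj₁ (ω-power q)) (cong proj₁ (ω̄-power q)) ⟩
    b * U q + U (suc p)              ∎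
    where
    p : ℕ
    p = suc q
    open Modular (+ p)
    ω+ω̄≡a : ω ⊕ ω̄ ≡ (a , + 0)
    ω+ω̄≡a = cong (_, + 0) (ℤ.+-identityˡ a)

  -- Discriminant: ω = ω̄ + δ, so for p = 2h+1 the ω-components give
  -- U_p ≡ -U_p + 2·D^h, i.e. U_p ≡ D^h (Euler's criterion in disguise).
  discriminant-congruence : ∀ h → Prime (suc (2 ℕ.* h)) → U (suc (2 ℕ.* h)) ≡ D ^ h mod + suc (2 ℕ.* h)
  discriminant-congruence h pr = halve (+ h) (odd-modulus h) (begin
    + 2 * U p                                ≡⟨ double (U p) ⟩
    U p - - U p                              ≡⟨ cong (λ u → proj₂ u - - U p) (ω-power (2 ℕ.* h)) ⟨
    proj₂ (ω ^Q p) - - U p                   ≡⟨ cong (λ u → proj₂ (u ^Q p) - - U p) ω̄+δ≡ω ⟨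
    proj₂ ((ω̄ ⊕ δ) ^Q p) - - U p             ≈⟨ sub-cong (proj₂ (frobenius pr ω̄ δ)) (≈-reflexive refl) ⟩
    proj₂ (ω̄ ^Q p) + proj₂ (δ ^Q p) - - U p  ≡⟨ cong₂ (λ s t → s + t - - U p) (cong proj₂ (ω̄-power (2 ℕ.* h)))
                                                                            (cong proj₂ (δ-power h)) ⟩
    - U p + + 2 * D ^ h - - U p              ≡⟨ cancel (U p) (+ 2 * D ^ h) ⟩
    + 2 * D ^ h                              ∎)
    where
    p : ℕ
    p = suc (2 ℕ.* h)
    open Modular (+ p)
    ω̄+δ≡ω : ω̄ ⊕ δ ≡ ω
    ω̄+δ≡ω = cong₂ _,_ (ℤ.+-inverseʳ a) refl
    double : ∀ u → + 2 * u ≡ u - - u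
    double = solve-∀
    cancel : ∀ u v → - u + v - - u ≡ v
    cancel = solve-∀

EvenOrOdd : ℕ → Set
EvenOrOdd n = (∃[ h ] n ≡ 2 ℕ.* h) ⊎ (∃[ h ] n ≡ suc (2 ℕ.* h))

parity : ∀ n → EvenOrOdd n
parity zero    = inj₁ (0 , refl)
parity (suc n) with parity n
... | inj₁ (h , refl) = inj₂ (h , refl)
... | inj₂ (h , refl) = inj₁ (suc h , ≡.sym (ℕ.*-suc 2 h))

even-cast : ∀ {n} h → n ≡ 2 ℕ.* h → + n ≡ + 2 * + h
even-cast h refl = ℤ.pos-* 2 h

odd-cast : ∀ {n} h → n ≡ suc (2 ℕ.* h) → + n ≡ + 1 + + 2 * + h
odd-cast h refl = odd-modulus h

odd≢even : ∀ x y → + 1 + + 2 * x ≢ + 2 * y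
odd≢even x y odd≡even = contradiction (ℕ.∣⇒≤ (∣⇒∣ᵤ 2∣1)) λ { (s≤s ()) }
  where
  difference : ∀ x y → + 1 ≡ (+ 1 + + 2 * x) - + 2 * x
  difference = solve-∀
  halved : ∀ x y → + 2 * y - + 2 * x ≡ (y - x) * + 2
  halved = solve-∀
  2∣1 : + 2 Signed.∣ + 1
  2∣1 = divides (y - x) (≡.trans (difference x y) (≡.trans (cong (_- + 2 * x) odd≡even) (halved x y)))

-- (m·a + 2k)² ≠ e²·(a² + 4b) when m, a, e are even and k is odd: the left
-- side is 4 times an odd square, the right side is divisible by 16.
odd-square-mismatch : ∀ {m a k e} b M A K E → m ≡ + 2 * M → a ≡ + 2 * A → k ≡ + 1 + + 2 * K → e ≡ + 2 * E →
                      (m * a + + 2 * k) * (m * a + + 2 * k) ≢ e * e * (a * a + + 4 * b)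
odd-square-mismatch b M A K E refl refl refl refl squares-equal =
  odd≢even W Y (ℤ.*-cancelˡ-≡ (+ 4) (+ 1 + + 2 * W) (+ 2 * Y)
    (≡.trans (≡.sym (four-times-odd M A K)) (≡.trans squares-equal (sixteen-times A E b))))
  where
  X : ℤ
  X = M * A + K
  W : ℤ
  W = + 2 * X * X + + 2 * X
  Y : ℤ
  Y = + 2 * E * E * (A * A + b)
  four-times-odd : ∀ M A K → (+ 2 * M * (+ 2 * A) + + 2 * (+ 1 + + 2 * K)) * (+ 2 * M * (+ 2 * A) + + 2 * (+ 1 + + 2 * K))
                             ≡ + 4 * (+ 1 + + 2 * (+ 2 * (M * A + K) * (M * A + K) + + 2 * (M * A + K)))
  four-times-odd = solve-∀
  sixteen-times : ∀ A E b → + 2 * E * (+ 2 * E) * (+ 2 * A * (+ 2 * A) + + 4 * b) ≡ + 4 * (+ 2 * (+ 2 * E * E * (A * A + b)))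
  sixteen-times = solve-∀

even-difference : ∀ {m k} l μ M K → m ≡ + 2 * M → k ≡ + 1 + + 2 * K → (m - k) * μ ≡ k * (k - + 1 - l) →
                  l - μ ≡ + 2 * (K * k - K * l - (M - K) * μ)
even-difference l μ M K refl refl srg = begin
  l - μ                                 ≡⟨ split M K l μ ⟩
  + 2 * A + ((m - k) * μ - R)           ≡⟨ cong (λ t → + 2 * A + (t - R)) srg ⟩
  + 2 * A + (R - R)                     ≡⟨ cancel (+ 2 * A) R ⟩
  + 2 * A                               ∎
  where
  open ≡.≡-Reasoning
  m : ℤ
  m = + 2 * M
  k : ℤ
  k = + 1 + + 2 * K
  A : ℤ
  A = K * k - K * l - (M - K) * μ
  R : ℤ
  R = k * (k - + 1 - l)
  split : ∀ M K l μ → l - μ ≡ + 2 * (K * (+ 1 + + 2 * K) - K * l - (M - K) * μ)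
                              + ((+ 2 * M - (+ 1 + + 2 * K)) * μ - (+ 1 + + 2 * K) * ((+ 1 + + 2 * K) - + 1 - l))
  split = solve-∀
  cancel : ∀ S X → S + (X - X) ≡ S
  cancel = solve-∀

even-gap : ∀ f g M → f + g ≡ + 2 * M → f - g ≡ + 2 * (M - g)
even-gap f g M f+g≡2M = begin
  f - g                ≡⟨ rewrite-sum f g ⟩
  (f + g) - + 2 * g    ≡⟨ cong (_- + 2 * g) f+g≡2M ⟩
  + 2 * M - + 2 * g    ≡⟨ factor M g ⟩
  + 2 * (M - g)        ∎
  where
  open ≡.≡-Reasoning
  rewrite-sum : ∀ f g → f - g ≡ (f + g) - + 2 * g
  rewrite-sum = solve-∀
  factor : ∀ M g → + 2 * M - + 2 * g ≡ + 2 * (M - g)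
  factor = solve-∀

module StronglyRegular (n k l μ : ℕ) where

  a b m N : ℤ
  a = + l - + μ
  b = + k - + μ
  m = + n - + 1
  N = numer n k l μ

  open LucasCongruences a b using (U; D; trace-congruence; discriminant-congruence)

  degree-equation : (m - + k) * + μ ≡ + k * (+ k - + 1 - + l) → + k * + k ≡ + μ * + n + a * + k + b
  degree-equation srg = begin
    + k * + k                       ≡⟨ split (+ n) (+ k) (+ l) (+ μ) ⟩
    S + (R - (m - + k) * + μ)       ≡⟨ cong (λ t → S + (R - t)) srg ⟩
    S + (R - R)                     ≡⟨ cancel S R ⟩
    S                               ∎
    where
    open ≡.≡-Reasoning
    S : ℤ
    S = + μ * + n + a * + k + b
    R : ℤ
    R = + k * (+ k - + 1 - + l)
    split : ∀ n k l μ → k * k ≡ μ * n + (l - μ) * k + (k - μ) + (k * (k - + 1 - l) - (n - + 1 - k) * μ)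
    split = solve-∀
    cancel : ∀ S X → S + (X - X) ≡ S
    cancel = solve-∀

  lucas-part : ℕ → ℤ
  lucas-part ℓ = m * U (suc ℓ) - (m * a + + k) * U ℓ

  lucas-part-recurrence : ∀ ℓ → lucas-part (suc (suc ℓ)) ≡ a * lucas-part (suc ℓ) + b * lucas-part ℓ
  lucas-part-recurrence ℓ = shift m a b (+ k) (U ℓ) (U (suc ℓ))
    where
    shift : ∀ m a b k U₀ U₁ →
      m * (a * (a * U₁ + b * U₀) + b * U₁) - (m * a + k) * (a * U₁ + b * U₀)
        ≡ a * (m * (a * U₁ + b * U₀) - (m * a + k) * U₁) + b * (m * U₁ - (m * a + k) * U₀)
    shift = solve-∀

  k-power-recurrence : + k * + k ≡ + μ * + n + a * + k + b →
    ∀ ℓ → (+ k) ^ suc (suc ℓ) ≡ + μ * + n * (+ k) ^ ℓ + a * (+ k) ^ suc ℓ + b * (+ k) ^ ℓ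
  k-power-recurrence k² ℓ = begin
    + k * (+ k * K)                  ≡⟨ ℤ.*-assoc (+ k) (+ k) K ⟨
    + k * + k * K                    ≡⟨ cong (_* K) k² ⟩
    (+ μ * + n + a * + k + b) * K    ≡⟨ expand (+ μ * + n) a b (+ k) K ⟩
    + μ * + n * K + a * (+ k * K) + b * K ∎
    where
    open ≡.≡-Reasoning
    K : ℤ
    K = (+ k) ^ ℓ
    expand : ∀ M a b k K → (M + a * k + b) * K ≡ M * K + a * (k * K) + b * K
    expand = solve-∀

  closed-form : + k * + k ≡ + μ * + n + a * + k + b → ∀ ℓ → c n k l μ ℓ ≡ (+ k) ^ ℓ + lucas-part ℓ
  closed-form k² zero = initial₀ (+ n) a (+ k)
    where
    initial₀ : ∀ n a k → n ≡ + 1 + ((n - + 1) * + 1 - ((n - + 1) * a + k) * + 0)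
    initial₀ = solve-∀
  closed-form k² (suc zero) = initial₁ (+ n) a b (+ k)
    where
    initial₁ : ∀ n a b k → + 0 ≡ k * + 1 + ((n - + 1) * (a * + 1 + b * + 0) - ((n - + 1) * a + k) * + 1)
    initial₁ = solve-∀
  closed-form k² (suc (suc ℓ)) = begin
    + μ * + n * (+ k) ^ ℓ + a * c n k l μ (suc ℓ) + b * c n k l μ ℓ
      ≡⟨ cong₂ (λ s t → + μ * + n * (+ k) ^ ℓ + a * s + b * t) (closed-form k² (suc ℓ)) (closed-form k² ℓ) ⟩
    + μ * + n * (+ k) ^ ℓ + a * ((+ k) ^ suc ℓ + lucas-part (suc ℓ)) + b * ((+ k) ^ ℓ + lucas-part ℓ)
      ≡⟨ regroup (+ μ * + n * (+ k) ^ ℓ) a b ((+ k) ^ suc ℓ) ((+ k) ^ ℓ) (lucas-part (suc ℓ)) (lucas-part ℓ) ⟩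
    (+ μ * + n * (+ k) ^ ℓ + a * (+ k) ^ suc ℓ + b * (+ k) ^ ℓ) + (a * lucas-part (suc ℓ) + b * lucas-part ℓ)
      ≡⟨ cong₂ _+_ (k-power-recurrence k² ℓ) (lucas-part-recurrence ℓ) ⟨
    (+ k) ^ suc (suc ℓ) + lucas-part (suc (suc ℓ)) ∎
    where
    open ≡.≡-Reasoning
    regroup : ∀ M a b K₁ K₀ L₁ L₀ →
              M + a * (K₁ + L₁) + b * (K₀ + L₀) ≡ (M + a * K₁ + b * K₀) + (a * L₁ + b * L₀)
    regroup = solve-∀

  -- For an odd prime p = 2h + 1:  2·c_p ≡ 2k + m·a - N·D^h ≡ N - N = 0.
  c-odd-prime : + k * + k ≡ + μ * + n + a * + k + b → ∀ e → N * N ≡ e * e * D →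
                ∀ h → Prime (suc (2 ℕ.* h)) → c n k l μ (suc (2 ℕ.* h)) ≡ + 0 mod + suc (2 ℕ.* h)
  c-odd-prime k² e N²≡e²D h pr = halve (+ h) (odd-modulus h) (begin
    + 2 * c n k l μ p                                      ≡⟨ cong (+ 2 *_) (closed-form k² p) ⟩
    + 2 * ((+ k) ^ p + lucas-part p)                       ≡⟨ with-trace ((+ k) ^ p) m a b (+ k) (U q) (U p) ⟩
    + 2 * (+ k) ^ p + m * (b * U q + U (suc p)) - N * U p
      ≈⟨ sub-cong (+-cong (*-congˡ (+ 2) (fermat (+ k))) (*-congˡ m (≈-trans (≈-sym (trace-congruence pr)) (fermat a))))
                  (*-congˡ N (discriminant-congruence h pr)) ⟩
    + 2 * + k + m * a - N * D ^ h
      ≈⟨ sub-cong (≈-reflexive {+ 2 * + k + m * a} refl) (euler-criterion h pr N e D N²≡e²D) ⟩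
    + 2 * + k + m * a - N                                  ≡⟨ vanish m a (+ k) ⟩
    + 2 * + 0                                              ∎)
    where
    q : ℕ
    q = 2 ℕ.* h
    p : ℕ
    p = suc q
    open Modular (+ p)
    open Fermat pr
    with-trace : ∀ K m a b k X Y → + 2 * (K + (m * (a * Y + b * X) - (m * a + k) * Y))
                                   ≡ + 2 * K + m * (b * X + (a * Y + b * X)) - (m * a + + 2 * k) * Y
    with-trace = solve-∀
    vanish : ∀ m a k → + 2 * k + m * a - (m * a + + 2 * k) ≡ + 2 * + 0
    vanish = solve-∀

  c-two : c n k l μ 2 ≡ + k * + n
  c-two = collapse (+ μ) (+ n) (+ k) (+ l)
    where
    collapse : ∀ μ n k l → μ * n * + 1 + (l - μ) * + 0 + (k - μ) * n ≡ k * n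
    collapse = solve-∀

  -- 2 divides c₂ = kn: if n and k were both odd, then m, a and f - g would
  -- be even and N² = (f - g)²·D would fail modulo 16.
  c-two-even : (m - + k) * + μ ≡ + k * (+ k - + 1 - + l) → ∀ f g → + f + + g ≡ m →
               N * N ≡ (+ f - + g) * (+ f - + g) * D → + 2 Signed.∣ c n k l μ 2
  c-two-even srg f g f+g≡m N²≡e²D = ≡.subst (+ 2 Signed.∣_) (≡.sym c-two) (two-divides (parity k) (parity n))
    where
    2∣even : ∀ {x} h → x ≡ 2 ℕ.* h → + 2 Signed.∣ + x
    2∣even h x≡2h = divides (+ h) (≡.trans (even-cast h x≡2h) (ℤ.*-comm (+ 2) (+ h)))
    two-divides : EvenOrOdd k → EvenOrOdd n → + 2 Signed.∣ + k * + n
    two-divides (inj₁ (K , k≡2K)) _                     = ∣m⇒∣m*n (+ n) (2∣even K k≡2K)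
    two-divides (inj₂ _)          (inj₁ (M , n≡2M))     = ∣n⇒∣m*n (+ k) (2∣even M n≡2M)
    two-divides (inj₂ (K , k≡1+2K)) (inj₂ (M , n≡1+2M)) =
      ⊥-elim (odd-square-mismatch b (+ M) A (+ K) (+ M - + g) m-even a-even k-odd f-g-even N²≡e²D)
      where
      drop-one : ∀ X → (+ 1 + X) - + 1 ≡ X
      drop-one = solve-∀
      m-even : m ≡ + 2 * + M
      m-even = ≡.trans (cong (_- + 1) (odd-cast M n≡1+2M)) (drop-one (+ 2 * + M))
      k-odd : + k ≡ + 1 + + 2 * + K
      k-odd = odd-cast K k≡1+2K
      A : ℤ
      A = + K * + k - + K * + l - (+ M - + K) * + μ
      a-even : a ≡ + 2 * A
      a-even = even-difference (+ l) (+ μ) (+ M) (+ K) m-even k-odd srg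
      f-g-even : + f - + g ≡ + 2 * (+ M - + g)
      f-g-even = even-gap (+ f) (+ g) (+ M) (≡.trans f+g≡m m-even)

even-prime : ∀ h → Prime (2 ℕ.* h) → 2 ℕ.* h ≡ 2
even-prime h pr with prime⇒irreducible pr (divides h (ℕ.*-comm 2 h))
... | inj₁ ()
... | inj₂ 2≡2h = ≡.sym 2≡2h

theorem3 : (n k l μ : ℕ) → 0 < k → k < n ∸ 1
    → ((+ n) - (+ 1) - (+ k)) * (+ μ) ≡ (+ k) * ((+ k) - (+ 1) - (+ l))
    → MultiplicitiesIntegral n k l μ
    → (p : ℕ) → Prime p → (+ p) ∣ c n k l μ p
theorem3 n k l μ _ _ srg (_ , f , g , f+g≡m , N²≡e²D , _) p pr = ∣⇒∣ᵤ (c-divisible p pr (parity p))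
  where
  open StronglyRegular n k l μ
  c-divisible : ∀ p → Prime p → EvenOrOdd p → + p Signed.∣ c n k l μ p
  c-divisible _ pr (inj₁ (h , refl)) rewrite even-prime h pr = c-two-even srg f g f+g≡m N²≡e²D
  c-divisible _ pr (inj₂ (h , refl)) =
    Modular.≈0⇒∣ (+ suc (2 ℕ.* h)) (c-odd-prime (degree-equation srg) (+ f - + g) N²≡e²D h pr)
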